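{- Let $\mathcal{A}=(A,I,V_i)$ be a fuzzy relational system, let $E$ and $F$ be fuzzy equivalences on $A$ with $E\le F$, and let $\mathcal{A}/E=(A/E,I,V_i^{A/E})$ be the quotient fuzzy relational system of $\mathcal{A}$ with respect to $E$. Then the fuzzy relation $F/E$ on $A/E$ defined by $F/E(E_{a_1},E_{a_2})=F(a_1,a_2)$ for all $a_1,a_2\in A$ is a (well-defined) fuzzy equivalence on $A/E$, and the quotient fuzzy relational systems $(\mathcal{A}/E)/(F/E)$ and $\mathcal{A}/F$ are isomorphic.
   Context: $\mathcal{L}=(L,\wedge,\vee,\otimes,\to,0,1)$ is a complete residuated lattice. $\mathcal{R}(A)$: fuzzy relations $A\times A\to L$ ordered pointwise; $(R\circ S)(a,c)=\bigvee_b R(a,b)\otimes S(b,c)$. A fuzzy equivalence on $A$ is $E\in\mathcal{R}(A)$ which is reflexive ($E(a,a)=1$), symmetric ($E(a,b)=E(b,a)$) and transitive ($E(a,b)\otimes E(b,c)\le E(a,c)$). $E_a$ is the fuzzy set $x\mapsto E(a,x)$, $A/E=\{E_a:a\in A\}$. A fuzzy relational system is $\mathcal{A}=(A,I,V_i)$ with $A$ non-empty, $I$ non-empty and $V_i\in\mathcal{R}(A)$ for $i\in I$; its quotient by a fuzzy equivalence $E$ is $\mathcal{A}/E=(A/E,I,V_i^{A/E})$ with $V_i^{A/E}(E_{a_1},E_{a_2})=(E\circ V_i\circ E)(a_1,a_2)$ (well defined). Systems $(A,I,V_i)$ and $(B,I,W_i)$ are isomorphic if there is a bijection $\varphi:A\to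 B$ with $V_i(a_1,a_2)=W_i(\varphi(a_1),\varphi(a_2))$ for all $a_1,a_2\in A$, $i\in I$. -}

module Defs where

open import Level using (0ℓ)
open import Data.Product using (Σ; _×_; _,_)
open import Relation.Binary.Bundles using (Setoid)
open import Relation.Binary.PropositionalEquality as ≡ using (_≡_; refl; sym; trans; cong; cong₂)
open import Function.Bundles using (Bijection)

record CompleteResiduatedLattice : Set₁ where
  infix  4 _≤_
  infixr 7 _⊗_
  infixr 6 _∧_
  infixr 5 _∨_
  infixr 5 _⇒_
  field
    L        : Set
    _≤_      : L → L → Set
    ≤-refl    : ∀ {x} → x ≤ x
    ≤-trans   : ∀ {x y z} → x ≤ y → y ≤ z → x ≤ z
    ≤-antisym : ∀ {x y} → x ≤ y → y ≤ x → x ≡ y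
    _∧_ _∨_ _⊗_ _⇒_ : L → L → L
    𝟘 𝟙      : L
    ∧-lowerˡ : ∀ x y → x ∧ y ≤ x
    ∧-lowerʳ : ∀ x y → x ∧ y ≤ y
    ∧-greatest : ∀ {x y z} → z ≤ x → z ≤ y → z ≤ x ∧ y
    ∨-upperˡ : ∀ x y → x ≤ x ∨ y
    ∨-upperʳ : ∀ x y → y ≤ x ∨ y
    ∨-least  : ∀ {x y z} → x ≤ z → y ≤ z → x ∨ y ≤ z
    𝟘-least  : ∀ x → 𝟘 ≤ x
    𝟙-greatest : ∀ x → x ≤ 𝟙
    ⋁ : {X : Set} → (X → L) → L
    ⋁-upper : {X : Set} (f : X → L) (x : X) → f x ≤ ⋁ f
    ⋁-least : {X : Set} (f : X → L) {z : L} → (∀ x → f x ≤ z) → ⋁ f ≤ z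
    ⋀ : {X : Set} → (X → L) → L
    ⋀-lower : {X : Set} (f : X → L) (x : X) → ⋀ f ≤ f x
    ⋀-greatest : {X : Set} (f : X → L) {z : L} → (∀ x → z ≤ f x) → z ≤ ⋀ f
    ⊗-assoc : ∀ x y z → (x ⊗ y) ⊗ z ≡ x ⊗ (y ⊗ z)
    ⊗-comm  : ∀ x y → x ⊗ y ≡ y ⊗ x
    ⊗-identityˡ : ∀ x → 𝟙 ⊗ x ≡ x
    adjoint-⇒ : ∀ {x y z} → x ⊗ y ≤ z → x ≤ y ⇒ z
    adjoint-⇐ : ∀ {x y z} → x ≤ y ⇒ z → x ⊗ y ≤ z

  ⋁-cong : {X : Set} {f g : X → L} → (∀ x → f x ≡ g x) → ⋁ f ≡ ⋁ g
  ⋁-cong {f = f} {g} eq =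
    ≤-antisym (⋁-least f (λ x → ≡.subst (_≤ ⋁ g) (sym (eq x)) (⋁-upper g x)))
              (⋁-least g (λ x → ≡.subst (_≤ ⋁ f) (eq x) (⋁-upper f x)))

module _ (𝓛 : CompleteResiduatedLattice) where
  open CompleteResiduatedLattice 𝓛

  compose : {C : Set} → (C → C → L) → (C → C → L) → (C → C → L)
  compose R S a c = ⋁ (λ b → R a b ⊗ S b c)

  record FuzzyRel (S : Setoid 0ℓ 0ℓ) : Set where
    open Setoid S using (_≈_) renaming (Carrier to C)
    field
      rel     : C → C → L
      rel-cong : ∀ {a a' b b'} → a ≈ a' → b ≈ b' → rel a b ≡ rel a' b'

  record FuzzyEquiv (S : Setoid 0ℓ 0ℓ) : Set where
    open Setoid S using (_≈_) renaming (Carrier to C)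
    field
      fuzzyRel : FuzzyRel S
    open FuzzyRel fuzzyRel public
    field
      reflexive  : ∀ a → rel a a ≡ 𝟙
      symmetric  : ∀ a b → rel a b ≡ rel b a
      transitive : ∀ a b c → rel a b ⊗ rel b c ≤ rel a c

  _≤R_ : ∀ {S} → FuzzyEquiv S → FuzzyEquiv S → Set
  _≤R_ {S} E F = ∀ a b → FuzzyEquiv.rel E a b ≤ FuzzyEquiv.rel F a b

  record FRS (S : Setoid 0ℓ 0ℓ) (I : Set) : Set where
    field
      carrier-nonempty : Setoid.Carrier S
      index-nonempty   : I
      V : I → FuzzyRel S

  -- The quotient set A/E = { E_a | a ∈ A }: an element E_a is represented
  -- by a, and E_a = E_b iff the fuzzy sets agree pointwise.
  QSetoid : {S : Setoid 0ℓ 0ℓ} → FuzzyEquiv S → Setoid 0ℓ 0ℓ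
  QSetoid {S} E = record
    { Carrier = Setoid.Carrier S
    ; _≈_ = λ a b → ∀ x → rel a x ≡ rel b x
    ; isEquivalence = record
      { refl = λ x → refl
      ; sym = λ p x → sym (p x)
      ; trans = λ p q x → trans (p x) (q x) } }
    where open FuzzyEquiv E

  quotientRel : {S : Setoid 0ℓ 0ℓ} (E : FuzzyEquiv S) → FuzzyRel S → FuzzyRel (QSetoid E)
  quotientRel {S} E V = record
    { rel = λ a b → compose (compose E.rel V.rel) E.rel a b
    ; rel-cong = λ {a} {a'} {b} {b'} p q →
        ⋁-cong (λ c → cong₂ _⊗_
          (⋁-cong (λ d → cong (_⊗ V.rel d c) (p d)))
          (trans (E.symmetric c b) (trans (q c) (E.symmetric b' c)))) }
    where
      module E = FuzzyEquiv E
      module V = FuzzyRel V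

  quotient : {S : Setoid 0ℓ 0ℓ} {I : Set} → FRS S I → (E : FuzzyEquiv S) → FRS (QSetoid E) I
  quotient 𝒜 E = record
    { carrier-nonempty = FRS.carrier-nonempty 𝒜
    ; index-nonempty = FRS.index-nonempty 𝒜
    ; V = λ i → quotientRel E (FRS.V 𝒜 i) }

  Isomorphic : {S T : Setoid 0ℓ 0ℓ} {I : Set} → FRS S I → FRS T I → Set
  Isomorphic {S} {T} {I} 𝒜 𝓑 =
    Σ (Bijection S T) λ φ →
      ∀ (i : I) a₁ a₂ →
        FuzzyRel.rel (FRS.V 𝒜 i) a₁ a₂
          ≡ FuzzyRel.rel (FRS.V 𝓑 i) (Bijection.to φ a₁) (Bijection.to φ a₂)

module Submission where

-- Write R ∘ S for the sup-⊗ composition of fuzzy relations.  The whole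
-- argument rests on two facts about composition in a complete residuated
-- lattice:
--   * ∘ is associative (⊗ distributes over ⋁, and ⋁'s can be interchanged);
--   * if E is reflexive, F is transitive and E ≤ F, then F absorbs E:
--     E ∘ F = F = F ∘ E.
-- Absorption gives well-definedness of F/E: E_a = E_a' implies
-- F(a,b) = (E ∘ F)(a,b) = (E ∘ F)(a',b) = F(a',b); reflexivity, symmetry
-- and transitivity are inherited from F.  The classes of F/E on A/E are
-- exactly the classes of F on A, so the identity map is the bijection, and
-- the isomorphism condition is the equality of relations
--   F ∘ (E ∘ V ∘ E) ∘ F = (F ∘ E) ∘ V ∘ (E ∘ F) = F ∘ V ∘ F,
-- obtained by reassociating and absorbing.

open import Defs
open import Level using (0ℓ)
open import Data.Product using (Σ; _×_; _,_)
open import Relation.Binary.Bundles using (Setoid; Poset)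
open import Relation.Binary.PropositionalEquality
  using (_≡_; setoid; refl; sym; trans; cong; cong₂; isEquivalence)
import Relation.Binary.PropositionalEquality as ≡
import Relation.Binary.Reasoning.PartialOrder as PosetReasoning
import Relation.Binary.Reasoning.Setoid as SetoidReasoning
import Function.Construct.Identity as Identity

module Lattice (𝓛 : CompleteResiduatedLattice) where
  open CompleteResiduatedLattice 𝓛

  poset : Poset 0ℓ 0ℓ 0ℓ
  poset = record
    { Carrier = L ; _≈_ = _≡_ ; _≤_ = _≤_
    ; isPartialOrder = record
      { isPreorder = record
        { isEquivalence = isEquivalence
        ; reflexive = λ { refl → ≤-refl }
        ; trans = ≤-trans }
      ; antisym = ≤-antisym } }

  open PosetReasoning poset public

  ⊗-identityʳ : ∀ x → x ⊗ 𝟙 ≡ x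
  ⊗-identityʳ x = trans (⊗-comm x 𝟙) (⊗-identityˡ x)

  -- ⊗ is monotone: x ⊗ - is left adjoint to - ⇒ (x ⊗ y).
  ⊗-monoˡ : ∀ {x x' y} → x ≤ x' → x ⊗ y ≤ x' ⊗ y
  ⊗-monoˡ p = adjoint-⇐ (≤-trans p (adjoint-⇒ ≤-refl))

  ⊗-monoʳ : ∀ {x y y'} → y ≤ y' → x ⊗ y ≤ x ⊗ y'
  ⊗-monoʳ {x} {y} {y'} p = begin
    x ⊗ y   ≡⟨ ⊗-comm x y ⟩
    y ⊗ x   ≤⟨ ⊗-monoˡ p ⟩
    y' ⊗ x  ≡⟨ ⊗-comm y' x ⟩
    x ⊗ y'  ∎

  -- ⊗ distributes over arbitrary joins, because it is a left adjoint.
  ⋁-distribʳ : {X : Set} (f : X → L) (y : L) → ⋁ f ⊗ y ≡ ⋁ (λ i → f i ⊗ y)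
  ⋁-distribʳ f y = ≤-antisym
    (adjoint-⇐ (⋁-least f (λ i → adjoint-⇒ (⋁-upper (λ j → f j ⊗ y) i))))
    (⋁-least (λ i → f i ⊗ y) (λ i → ⊗-monoˡ (⋁-upper f i)))

  ⋁-distribˡ : {X : Set} (x : L) (f : X → L) → x ⊗ ⋁ f ≡ ⋁ (λ i → x ⊗ f i)
  ⋁-distribˡ x f = begin-equality
    x ⊗ ⋁ f              ≡⟨ ⊗-comm x (⋁ f) ⟩
    ⋁ f ⊗ x              ≡⟨ ⋁-distribʳ f x ⟩
    ⋁ (λ i → f i ⊗ x)    ≡⟨ ⋁-cong (λ i → ⊗-comm (f i) x) ⟩
    ⋁ (λ i → x ⊗ f i)    ∎

  ⋁-swap-≤ : {X Y : Set} (f : X → Y → L) →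
             ⋁ (λ i → ⋁ (λ j → f i j)) ≤ ⋁ (λ j → ⋁ (λ i → f i j))
  ⋁-swap-≤ f = ⋁-least _ λ i → ⋁-least _ λ j → begin
    f i j                          ≤⟨ ⋁-upper (λ i' → f i' j) i ⟩
    ⋁ (λ i' → f i' j)              ≤⟨ ⋁-upper (λ j' → ⋁ (λ i' → f i' j')) j ⟩
    ⋁ (λ j' → ⋁ (λ i' → f i' j'))  ∎

  ⋁-swap : {X Y : Set} (f : X → Y → L) →
           ⋁ (λ i → ⋁ (λ j → f i j)) ≡ ⋁ (λ j → ⋁ (λ i → f i j))
  ⋁-swap f = ≤-antisym (⋁-swap-≤ f) (⋁-swap-≤ (λ j i → f i j))

module Composition (𝓛 : CompleteResiduatedLattice) {C : Set} where
  open CompleteResiduatedLattice 𝓛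
  open Lattice 𝓛

  Rel : Set
  Rel = C → C → L

  infixl 7 _∘_
  _∘_ : Rel → Rel → Rel
  _∘_ = compose 𝓛

  infix 4 _≐_
  _≐_ : Rel → Rel → Set
  R ≐ S = ∀ a b → R a b ≡ S a b

  ≐-setoid : Setoid 0ℓ 0ℓ
  ≐-setoid = record
    { Carrier = Rel ; _≈_ = _≐_
    ; isEquivalence = record
      { refl = λ a b → refl
      ; sym = λ p a b → sym (p a b)
      ; trans = λ p q a b → trans (p a b) (q a b) } }

  ∘-cong : ∀ {R R' S S'} → R ≐ R' → S ≐ S' → R ∘ S ≐ R' ∘ S'
  ∘-cong p q a c = ⋁-cong (λ b → cong₂ _⊗_ (p a b) (q b c))

  ∘-assoc : ∀ R S T → R ∘ S ∘ T ≐ R ∘ (S ∘ T)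
  ∘-assoc R S T a d = begin-equality
    ⋁ (λ c → ⋁ (λ b → R a b ⊗ S b c) ⊗ T c d)
      ≡⟨ ⋁-cong (λ c → ⋁-distribʳ (λ b → R a b ⊗ S b c) (T c d)) ⟩
    ⋁ (λ c → ⋁ (λ b → (R a b ⊗ S b c) ⊗ T c d))
      ≡⟨ ⋁-swap (λ c b → (R a b ⊗ S b c) ⊗ T c d) ⟩
    ⋁ (λ b → ⋁ (λ c → (R a b ⊗ S b c) ⊗ T c d))
      ≡⟨ ⋁-cong (λ b → ⋁-cong (λ c → ⊗-assoc (R a b) (S b c) (T c d))) ⟩
    ⋁ (λ b → ⋁ (λ c → R a b ⊗ (S b c ⊗ T c d)))
      ≡⟨ ⋁-cong (λ b → ⋁-distribˡ (R a b) (λ c → S b c ⊗ T c d)) ⟨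
    ⋁ (λ b → R a b ⊗ ⋁ (λ c → S b c ⊗ T c d))
      ∎

  module Absorption (E F : Rel)
      (E-refl : ∀ a → E a a ≡ 𝟙)
      (E≤F : ∀ a b → E a b ≤ F a b)
      (F-trans : ∀ a b c → F a b ⊗ F b c ≤ F a c) where

    absorbˡ : E ∘ F ≐ F
    absorbˡ a b = ≤-antisym
      (⋁-least _ λ c → ≤-trans (⊗-monoˡ (E≤F a c)) (F-trans a c b))
      (begin
        F a b          ≡⟨ ⊗-identityˡ (F a b) ⟨
        𝟙 ⊗ F a b      ≡⟨ cong (_⊗ F a b) (E-refl a) ⟨
        E a a ⊗ F a b  ≤⟨ ⋁-upper (λ c → E a c ⊗ F c b) a ⟩
        (E ∘ F) a b    ∎)

    absorbʳ : F ∘ E ≐ F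
    absorbʳ a b = ≤-antisym
      (⋁-least _ λ c → ≤-trans (⊗-monoʳ (E≤F c b)) (F-trans a c b))
      (begin
        F a b          ≡⟨ ⊗-identityʳ (F a b) ⟨
        F a b ⊗ 𝟙      ≡⟨ cong (F a b ⊗_) (E-refl b) ⟨
        F a b ⊗ E b b  ≤⟨ ⋁-upper (λ c → F a c ⊗ E c b) b ⟩
        (F ∘ E) a b    ∎)

module SecondIsomorphism (𝓛 : CompleteResiduatedLattice) {A : Set}
    (E F : FuzzyEquiv 𝓛 (setoid A)) (E≤F : _≤R_ 𝓛 E F) where
  open CompleteResiduatedLattice 𝓛
  open Composition 𝓛 {A}
  module E = FuzzyEquiv E
  module F = FuzzyEquiv F
  open Absorption E.rel F.rel E.reflexive E≤F F.transitive

  -- F is constant on E-classes in its first argument, since E ∘ F = F.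
  F-respects-E : ∀ {a a'} → (∀ x → E.rel a x ≡ E.rel a' x) →
                 ∀ b → F.rel a b ≡ F.rel a' b
  F-respects-E {a} {a'} p b = begin
    F.rel a b             ≡⟨ absorbˡ a b ⟨
    (E.rel ∘ F.rel) a b   ≡⟨ ⋁-cong (λ x → cong (_⊗ F.rel x b) (p x)) ⟩
    (E.rel ∘ F.rel) a' b  ≡⟨ absorbˡ a' b ⟩
    F.rel a' b            ∎
    where open ≡.≡-Reasoning

  F/E : FuzzyEquiv 𝓛 (QSetoid 𝓛 E)
  F/E = record
    { fuzzyRel = record
      { rel = F.rel
      ; rel-cong = λ {a} {a'} {b} {b'} p q → begin
          F.rel a b   ≡⟨ F-respects-E p b ⟩
          F.rel a' b  ≡⟨ F.symmetric a' b ⟩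
          F.rel b a'  ≡⟨ F-respects-E q a' ⟩
          F.rel b' a' ≡⟨ F.symmetric b' a' ⟩
          F.rel a' b' ∎ }
    ; reflexive = F.reflexive
    ; symmetric = F.symmetric
    ; transitive = F.transitive }
    where open ≡.≡-Reasoning

  double-quotient : ∀ V → F.rel ∘ (E.rel ∘ V ∘ E.rel) ∘ F.rel ≐ F.rel ∘ V ∘ F.rel
  double-quotient V = begin
    F.rel ∘ (E.rel ∘ V ∘ E.rel) ∘ F.rel
      ≈⟨ ∘-cong (∘-assoc F.rel (E.rel ∘ V) E.rel) (λ _ _ → refl) ⟨
    F.rel ∘ (E.rel ∘ V) ∘ E.rel ∘ F.rel
      ≈⟨ ∘-cong (∘-cong (∘-assoc F.rel E.rel V) (λ _ _ → refl)) (λ _ _ → refl) ⟨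
    F.rel ∘ E.rel ∘ V ∘ E.rel ∘ F.rel
      ≈⟨ ∘-assoc (F.rel ∘ E.rel ∘ V) E.rel F.rel ⟩
    F.rel ∘ E.rel ∘ V ∘ (E.rel ∘ F.rel)
      ≈⟨ ∘-cong (∘-cong absorbʳ (λ _ _ → refl)) absorbˡ ⟩
    F.rel ∘ V ∘ F.rel
      ∎
    where open SetoidReasoning ≐-setoid

theorem6p3 : (𝓛 : CompleteResiduatedLattice) {A I : Set}
    (𝒜 : FRS 𝓛 (setoid A) I) (E F : FuzzyEquiv 𝓛 (setoid A)) →
    _≤R_ 𝓛 E F →
    Σ (FuzzyEquiv 𝓛 (QSetoid 𝓛 E)) λ FE →
      (∀ a₁ a₂ → FuzzyEquiv.rel FE a₁ a₂ ≡ FuzzyEquiv.rel F a₁ a₂)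
      × Isomorphic 𝓛 (quotient 𝓛 (quotient 𝓛 𝒜 E) FE) (quotient 𝓛 𝒜 F)
theorem6p3 𝓛 𝒜 E F E≤F =
  F/E , (λ _ _ → refl) , Identity.bijection (QSetoid 𝓛 F) ,
  (λ i → double-quotient (FuzzyRel.rel (FRS.V 𝒜 i)))
  where open SecondIsomorphism 𝓛 E F E≤F
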